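{- Let $\mathcal{T}=(t_n)_{n=0}^\infty$ be the Thue-Morse sequence over $\mathbb{F}_2$, i.e. $t_n \equiv s_1(n) \bmod 2$, where $s_1(n)$ is the number of ones in the binary expansion of the nonnegative integer $n$. Let $\mathcal{T}'=(t_{i^2})_{i=0}^\infty$ be its subsequence along the squares. Then for every integer $N\ge 21$, the $N$th maximum order complexity of $\mathcal{T}'$ satisfies $$M(\mathcal{T}',N)\ge \sqrt{\frac{2N}{5}}.$$
   Context: For a positive integer $N$ and a sequence $\mathcal{S}=(s_i)_{i=0}^\infty$ over $\mathbb{F}_2$ with $(s_0,\ldots,s_{N-2})$ not constant, the $N$th maximum order complexity $M(\mathcal{S},N)$ is the smallest positive integer $M$ such that there is a polynomial $f\in\mathbb{F}_2[x_1,\ldots,x_M]$ with $s_{i+M}=f(s_i,s_{i+1},\ldots,s_{i+M-1})$ for all $0\le i\le N-M-1$. If $s_i=a$ for all $i=0,\ldots,N-2$, then $M(\mathcal{S},N)=0$ if $s_{N-1}=a$ and $M(\mathcal{S},N)=N-1$ if $s_{N-1}\ne a$. -}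

module Defs where

open import Data.Bool using (Bool; true; false)
open import Data.Nat using (ℕ; zero; suc; _+_; _*_; _∸_; _≤_; _<_; _%_; _/_; _≡ᵇ_)
open import Data.Fin using (Fin; toℕ)
open import Data.Vec using (Vec; tabulate)
open import Data.Product using (Σ; _×_)
open import Data.Sum using (_⊎_)
open import Relation.Binary.PropositionalEquality using (_≡_; _≢_)
open import Relation.Nullary using (¬_)

-- Binary sequences over F₂ (F₂ represented by Bool, false = 0, true = 1).
Seq : Set
Seq = ℕ → Bool

popcountFuel : ℕ → ℕ → ℕ
popcountFuel zero    n = 0
popcountFuel (suc k) n = n % 2 + popcountFuel k (n / 2)

-- s₁(n): number of ones in the binary expansion of n (n < 2^n, so n digits suffice)
s₁ : ℕ → ℕ
s₁ n = popcountFuel n n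

thueMorse : Seq
thueMorse n = (s₁ n % 2) ≡ᵇ 1

thueMorseSquares : Seq
thueMorseSquares i = thueMorse (i * i)

window : Seq → ℕ → (M : ℕ) → Vec Bool M
window S i M = tabulate (λ j → S (i + toℕ j))

-- there is a feedback function f of M variables (every function F₂^M → F₂ is a polynomial)
-- with s_{i+M} = f(s_i,…,s_{i+M-1}) for all 0 ≤ i ≤ N-M-1
HasFeedback : Seq → ℕ → ℕ → Set
HasFeedback S N M =
  Σ (Vec Bool M → Bool) λ f → ∀ i → i + M + 1 ≤ N → S (i + M) ≡ f (window S i M)

ConstPrefix : Seq → ℕ → Bool → Set
ConstPrefix S N a = ∀ i → i + 2 ≤ N → S i ≡ a

IsMOC : Seq → ℕ → ℕ → Set
IsMOC S N M =
  (¬ (Σ Bool λ a → ConstPrefix S N a)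
     × 0 < M × HasFeedback S N M
     × (∀ M' → 0 < M' → M' < M → ¬ HasFeedback S N M'))
  ⊎ (Σ Bool λ a → ConstPrefix S N a
       × ((S (N ∸ 1) ≡ a × M ≡ 0) ⊎ (S (N ∸ 1) ≢ a × M ≡ N ∸ 1)))

-- A feedback function of order M is impossible once two windows of length M ≥ L agree
-- but are followed by different terms, so such a collision of length L forces
-- M(T′, N) > L. For k ≥ 2 let P = 2^(k+1) and Q = 2^(2k), so that P² = 4Q. Writing
-- 2Q − j = 2v + j and 8Q − j = 8v + 7j with v + j = Q and 0 < j < P, the squares
-- (2v + j)² = 4Qv + j² and (8v + 7j)² = 16Q(3Q + v) + j² have digit sums differing by 2;
-- for 0 ≤ i ≤ P the squares of 2Q + i and 8Q + i both have digit sum 1 + s₁(i) + s₁(i²).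
-- Hence the windows of length 2P starting at 2Q − P + 1 and 8Q − P + 1 agree, while at
-- i = P + 1 the digit sums are 5 and 6. These windows lie in the first N terms once
-- N ≥ 8Q + P + 2, and taking k maximal gives 2N ≤ 5(2P + 1)². Two explicit collisions
-- cover 21 ≤ N < 138.
module Submission where

open import Data.Bool using (Bool; true; false)
import Data.Bool as Bool
open import Data.Empty using (⊥-elim)
open import Data.Fin using (toℕ; fromℕ<)
open import Data.Fin.Properties using (toℕ<n; toℕ-fromℕ<)
open import Data.Nat
open import Data.Nat.DivMod
open import Data.Nat.Induction using (<-rec)
open import Data.Nat.Properties
open import Data.Nat.Tactic.RingSolver using (solve-∀)
open import Data.Product using (Σ; ∃-syntax; _×_; _,_)
open import Data.Sum using (_⊎_; inj₁; inj₂)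
open import Data.Unit using (tt)
open import Data.Vec using (Vec; lookup)
open import Data.Vec.Properties using (tabulate-cong; lookup∘tabulate; ≡-dec)
open import Relation.Binary.PropositionalEquality
open import Relation.Nullary
open import Relation.Nullary.Decidable using (toWitness; _×-dec_; ¬?)
open import Relation.Unary using (Decidable)

open import Defs

popcountFuel-digit : ∀ k b q → b < 2 →
  popcountFuel (suc k) (b + q * 2) ≡ b + popcountFuel k q
popcountFuel-digit k b q b<2 = cong₂ (λ x y → x + popcountFuel k y) low-digit rest
  where
  open ≡-Reasoning
  low-digit : (b + q * 2) % 2 ≡ b
  low-digit = trans ([m+kn]%n≡m%n b q 2) (m<n⇒m%n≡m b<2)
  no-carry : b % 2 + (q * 2) % 2 < 2
  no-carry = subst (_< 2) (sym (trans (cong₂ _+_ (m<n⇒m%n≡m b<2) (m*n%n≡0 q 2)) (+-identityʳ b))) b<2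
  rest : (b + q * 2) / 2 ≡ q
  rest = begin
    (b + q * 2) / 2     ≡⟨ +-distrib-/ b (q * 2) no-carry ⟩
    b / 2 + q * 2 / 2   ≡⟨ cong₂ _+_ (m<n⇒m/n≡0 b<2) (m*n/n≡m q 2) ⟩
    q                   ∎

popcountFuel-split : ∀ p k a r → r < 2 ^ p →
  popcountFuel (p + k) (a * 2 ^ p + r) ≡ popcountFuel k a + popcountFuel p r
popcountFuel-split zero k a zero _
  rewrite *-identityʳ a | +-identityʳ a | +-identityʳ (popcountFuel k a) = refl
popcountFuel-split zero k a (suc r) (s≤s ())
popcountFuel-split (suc p) k a r r<2^[1+p] = begin
  popcountFuel (suc (p + k)) (a * 2 ^ suc p + r)
    ≡⟨ cong (popcountFuel (suc (p + k))) split-low-digit ⟩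
  popcountFuel (suc (p + k)) (r % 2 + (a * 2 ^ p + r / 2) * 2)
    ≡⟨ popcountFuel-digit (p + k) (r % 2) _ (m%n<n r 2) ⟩
  r % 2 + popcountFuel (p + k) (a * 2 ^ p + r / 2)
    ≡⟨ cong (r % 2 +_) (popcountFuel-split p k a (r / 2) (m<n*o⇒m/o<n r<2^p*2)) ⟩
  r % 2 + (popcountFuel k a + popcountFuel p (r / 2))
    ≡⟨ +-comm-middle (r % 2) (popcountFuel k a) (popcountFuel p (r / 2)) ⟩
  popcountFuel k a + (r % 2 + popcountFuel p (r / 2)) ∎
  where
  open ≡-Reasoning
  r<2^p*2 : r < 2 ^ p * 2
  r<2^p*2 = subst (r <_) (*-comm 2 (2 ^ p)) r<2^[1+p]
  +-comm-middle : ∀ x y z → x + (y + z) ≡ y + (x + z)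
  +-comm-middle = solve-∀
  shift : ∀ a x b c → a * (2 * x) + (b + c * 2) ≡ b + (a * x + c) * 2
  shift = solve-∀
  split-low-digit : a * 2 ^ suc p + r ≡ r % 2 + (a * 2 ^ p + r / 2) * 2
  split-low-digit = trans (cong (a * 2 ^ suc p +_) (m≡m%n+[m/n]*n r 2))
                          (shift a (2 ^ p) (r % 2) (r / 2))

popcountFuel-zero : ∀ k → popcountFuel k 0 ≡ 0
popcountFuel-zero zero    = refl
popcountFuel-zero (suc k) = popcountFuel-zero k

popcountFuel-surplus : ∀ k d {n} → n < 2 ^ k → popcountFuel (k + d) n ≡ popcountFuel k n
popcountFuel-surplus k d {n} n<2^k =
  trans (popcountFuel-split k d 0 n n<2^k) (cong (_+ popcountFuel k n) (popcountFuel-zero d))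

n<2^n : ∀ n → n < 2 ^ n
n<2^n zero    = s≤s z≤n
n<2^n (suc n) = +-mono-≤-< (m^n>0 2 n) (subst (n <_) (sym (+-identityʳ (2 ^ n))) (n<2^n n))

s₁≡popcountFuel : ∀ k {n} → n < 2 ^ k → s₁ n ≡ popcountFuel k n
s₁≡popcountFuel k {n} n<2^k = begin
  popcountFuel n n        ≡⟨ popcountFuel-surplus n k (n<2^n n) ⟨
  popcountFuel (n + k) n  ≡⟨ cong (λ m → popcountFuel m n) (+-comm n k) ⟩
  popcountFuel (k + n) n  ≡⟨ popcountFuel-surplus k n n<2^k ⟩
  popcountFuel k n        ∎
  where open ≡-Reasoning

a*2^p+r<2^[p+a] : ∀ p a {r} → r < 2 ^ p → a * 2 ^ p + r < 2 ^ (p + a)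
a*2^p+r<2^[p+a] p a {r} r<2^p = begin-strict
  a * 2 ^ p + r        <⟨ +-monoʳ-< (a * 2 ^ p) r<2^p ⟩
  a * 2 ^ p + 2 ^ p    ≡⟨ +-comm (a * 2 ^ p) (2 ^ p) ⟩
  suc a * 2 ^ p        ≤⟨ *-monoˡ-≤ (2 ^ p) (n<2^n a) ⟩
  2 ^ a * 2 ^ p        ≡⟨ *-comm (2 ^ a) (2 ^ p) ⟩
  2 ^ p * 2 ^ a        ≡⟨ ^-distribˡ-+-* 2 p a ⟨
  2 ^ (p + a)          ∎
  where open ≤-Reasoning

2^p+r<2^[1+p] : ∀ p {r} → r < 2 ^ p → 2 ^ p + r < 2 ^ suc p
2^p+r<2^[1+p] p {r} r<2^p =
  subst (2 ^ p + r <_) (cong (2 ^ p +_) (sym (+-identityʳ (2 ^ p)))) (+-monoʳ-< (2 ^ p) r<2^p)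

s₁-split : ∀ p a {r} → r < 2 ^ p → s₁ (a * 2 ^ p + r) ≡ s₁ a + s₁ r
s₁-split p a {r} r<2^p = begin
  s₁ (a * 2 ^ p + r)                     ≡⟨ s₁≡popcountFuel (p + a) (a*2^p+r<2^[p+a] p a r<2^p) ⟩
  popcountFuel (p + a) (a * 2 ^ p + r)   ≡⟨ popcountFuel-split p a a r r<2^p ⟩
  s₁ a + popcountFuel p r                ≡⟨ cong (s₁ a +_) (s₁≡popcountFuel p r<2^p) ⟨
  s₁ a + s₁ r                            ∎
  where open ≡-Reasoning

s₁-2^p+ : ∀ p {r} → r < 2 ^ p → s₁ (2 ^ p + r) ≡ suc (s₁ r)
s₁-2^p+ p {r} r<2^p = trans (cong (λ x → s₁ (x + r)) (sym (*-identityˡ (2 ^ p)))) (s₁-split p 1 r<2^p)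

s₁-2^p : ∀ p → s₁ (2 ^ p) ≡ 1
s₁-2^p p = trans (cong s₁ (sym (+-identityʳ (2 ^ p)))) (s₁-2^p+ p (m^n>0 2 p))

thueMorse-value : ∀ {n m} → s₁ n ≡ m → thueMorse n ≡ (m % 2 ≡ᵇ 1)
thueMorse-value eq = cong (λ s → s % 2 ≡ᵇ 1) eq

thueMorse-cong : ∀ {m n} → s₁ m ≡ s₁ n → thueMorse m ≡ thueMorse n
thueMorse-cong {m} = thueMorse-value {m}

thueMorse-+2 : ∀ {m n} → s₁ n ≡ 2 + s₁ m → thueMorse m ≡ thueMorse n
thueMorse-+2 {m} eq = sym (cong (_≡ᵇ 1) (trans (cong (_% 2) (trans eq (+-comm 2 (s₁ m))))
                                               ([m+kn]%n≡m%n (s₁ m) 1 2)))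

window-≡⇒agree : ∀ S {i j M u} → window S i M ≡ window S j M → u < M → S (i + u) ≡ S (j + u)
window-≡⇒agree S {i} {j} {M} {u} eq u<M = begin
  S (i + u)                              ≡⟨ cong (λ v → S (i + v)) (toℕ-fromℕ< u<M) ⟨
  S (i + toℕ (fromℕ< u<M))               ≡⟨ lookup∘tabulate _ (fromℕ< u<M) ⟨
  lookup (window S i M) (fromℕ< u<M)     ≡⟨ cong (λ w → lookup w (fromℕ< u<M)) eq ⟩
  lookup (window S j M) (fromℕ< u<M)     ≡⟨ lookup∘tabulate _ (fromℕ< u<M) ⟩
  S (j + toℕ (fromℕ< u<M))               ≡⟨ cong (λ v → S (j + v)) (toℕ-fromℕ< u<M) ⟩
  S (j + u)                              ∎
  where open ≡-Reasoning

fits⇒< : ∀ {i M N} → i + M + 1 ≤ N → i < N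
fits⇒< {i} {M} {N} fits = <-≤-trans (s≤s (m≤m+n i M)) (subst (_≤ N) (+-comm (i + M) 1) fits)

record Collision (S : Seq) (N L : ℕ) : Set where
  field
    i j    : ℕ
    i-fits : i + L + 1 ≤ N
    j-fits : j + L + 1 ≤ N
    agree  : ∀ {u} → u < L → S (i + u) ≡ S (j + u)
    differ : S (i + L) ≢ S (j + L)

collision⇒¬feedback : ∀ {S N M} → Collision S N M → ¬ HasFeedback S N M
collision⇒¬feedback {S} {N} {M} c (f , feedback) = differ (begin
  S (i + M)            ≡⟨ feedback i i-fits ⟩
  f (window S i M)     ≡⟨ cong f (tabulate-cong (λ u → agree (toℕ<n u))) ⟩
  f (window S j M)     ≡⟨ feedback j j-fits ⟨
  S (j + M)            ∎)
  where
  open Collision c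
  open ≡-Reasoning

collision-shorten : ∀ {S N L M} → M ≤ L → Collision S N L → Collision S N M
collision-shorten {S} {N} {L} {M} M≤L c = record
  { i      = i + d
  ; j      = j + d
  ; i-fits = subst (λ x → x + 1 ≤ N) (sym (shifted i)) i-fits
  ; j-fits = subst (λ x → x + 1 ≤ N) (sym (shifted j)) j-fits
  ; agree  = λ {u} u<M → subst₂ (λ x y → S x ≡ S y) (sym (+-assoc i d u)) (sym (+-assoc j d u))
                           (agree (subst (d + u <_) (m∸n+n≡m M≤L) (+-monoʳ-< d u<M)))
  ; differ = subst₂ (λ x y → S x ≢ S y) (sym (shifted i)) (sym (shifted j)) differ
  }
  where
  open Collision c
  d : ℕ
  d = L ∸ M
  shifted : ∀ x → x + d + M ≡ x + L
  shifted x = trans (+-assoc x d M) (cong (x +_) (m∸n+n≡m M≤L))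

module _ (S : Seq) (N M : ℕ) where

  private
    Fits : ℕ → Set
    Fits i = i + M + 1 ≤ N

    Clash : ℕ → ℕ → Set
    Clash i j = Fits i × Fits j × (∀ {u} → u < M → S (i + u) ≡ S (j + u)) × S (i + M) ≢ S (j + M)

    clash? : ∀ i → Decidable (Clash i)
    clash? i j = (_ ≤? N) ×-dec (_ ≤? N)
      ×-dec allUpTo? (λ u → S (i + u) Bool.≟ S (j + u)) M ×-dec ¬? (S (i + M) Bool.≟ S (j + M))

    Realises : Vec Bool M → ℕ → Set
    Realises w i = Fits i × window S i M ≡ w

    realises? : ∀ w → Decidable (Realises w)
    realises? w i = (_ ≤? N) ×-dec ≡-dec Bool._≟_ (window S i M) w

    next : Vec Bool M → Bool
    next w with anyUpTo? (realises? w) N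
    ... | yes (i , _) = S (i + M)
    ... | no _        = false

    next-feedback : ¬ (∃[ i ] i < N × ∃[ j ] j < N × Clash i j) →
                    ∀ i → Fits i → S (i + M) ≡ next (window S i M)
    next-feedback no-clash i fits with anyUpTo? (realises? (window S i M)) N
    ... | no none = ⊥-elim (none (i , fits⇒< fits , fits , refl))
    ... | yes (i′ , i′<N , fits′ , same) with S (i + M) Bool.≟ S (i′ + M)
    ...   | yes eq = eq
    ...   | no neq = ⊥-elim (no-clash (i , fits⇒< fits , i′ , i′<N , fits , fits′ ,
                                         window-≡⇒agree S (sym same) , neq))

  feedback-or-collision : HasFeedback S N M ⊎ Collision S N M
  feedback-or-collision with anyUpTo? (λ i → anyUpTo? (clash? i) N) N
  ... | yes (i , _ , j , _ , i-fits , j-fits , agree , differ) =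
    inj₂ (record { i = i ; j = j ; i-fits = i-fits ; j-fits = j-fits ; agree = agree ; differ = differ })
  ... | no no-clash = inj₁ (next , next-feedback no-clash)

  hasFeedback? : Dec (HasFeedback S N M)
  hasFeedback? with feedback-or-collision
  ... | inj₁ feedback  = yes feedback
  ... | inj₂ collision = no (collision⇒¬feedback collision)

least : ∀ {p} {P : ℕ → Set p} → Decidable P → ∀ {m} → P m →
        ∃[ n ] P n × (∀ {k} → k < n → ¬ P k)
least {P = P} P? {m} = <-rec (λ m → P m → ∃[ n ] P n × (∀ {k} → k < n → ¬ P k)) step m
  where
  step : ∀ m → (∀ {k} → k < m → P k → ∃[ n ] P n × (∀ {k} → k < n → ¬ P k)) →
         P m → ∃[ n ] P n × (∀ {k} → k < n → ¬ P k)
  step m smaller Pm with anyUpTo? P? m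
  ... | yes (k , k<m , Pk) = smaller k<m Pk
  ... | no none            = m , Pm , λ k<m Pk → none (_ , k<m , Pk)

hasFeedback-full-order : ∀ S N → HasFeedback S N N
hasFeedback-full-order S N = (λ _ → false) , λ i fits → ⊥-elim (<-irrefl refl (<-≤-trans
  (s≤s (m≤n+m N i)) (subst (_≤ N) (+-comm (i + N) 1) fits)))

complexity-above-collision : ∀ {S N L} → ¬ Σ Bool (ConstPrefix S N) → Collision S N L →
                             ∃[ M ] IsMOC S N M × L < M
complexity-above-collision {S} {N} {L} nonconstant c
  with least (λ M → (0 <? M) ×-dec hasFeedback? S N M)
             (fits⇒< (Collision.i-fits c) , hasFeedback-full-order S N)
... | M , (0<M , feedback) , minimal =
  M , inj₁ (nonconstant , 0<M , feedback , λ _ 0<M′ M′<M feedback′ → minimal M′<M (0<M′ , feedback′))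
    , L<M
  where
  L<M : L < M
  L<M = ≰⇒> (λ M≤L → collision⇒¬feedback (collision-shorten M≤L c) feedback)

square-expand : ∀ x i → (2 * x + i) * (2 * x + i) ≡ (x + i) * (2 * (2 * x)) + i * i
square-expand = solve-∀

s₁-square-2^[1+p]+ : ∀ p {i} → i < 2 ^ p → i * i < 2 ^ (2 + p) →
  s₁ ((2 * 2 ^ p + i) * (2 * 2 ^ p + i)) ≡ suc (s₁ i) + s₁ (i * i)
s₁-square-2^[1+p]+ p {i} i<2^p i²<2^[2+p] = begin
  s₁ ((2 * 2 ^ p + i) * (2 * 2 ^ p + i))  ≡⟨ cong s₁ (square-expand (2 ^ p) i) ⟩
  s₁ ((2 ^ p + i) * 2 ^ (2 + p) + i * i)  ≡⟨ s₁-split (2 + p) (2 ^ p + i) i²<2^[2+p] ⟩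
  s₁ (2 ^ p + i) + s₁ (i * i)             ≡⟨ cong (_+ s₁ (i * i)) (s₁-2^p+ p i<2^p) ⟩
  suc (s₁ i) + s₁ (i * i)                 ∎
  where open ≡-Reasoning

threshold : ℕ → ℕ
threshold k = 8 * 2 ^ (k + k) + 2 ^ suc k + 2

module SquaresCollision (k : ℕ) (2≤k : 2 ≤ k) where

  P Q Q₄ Q₁₆ : ℕ
  P   = 2 ^ suc k
  Q   = 2 ^ (k + k)
  Q₄  = 2 ^ (2 + (k + k))
  Q₁₆ = 2 ^ (4 + (k + k))

  private
    S : Seq
    S = thueMorseSquares

  2^[1+k+1+k]≡Q₄ : 2 ^ (suc k + suc k) ≡ Q₄
  2^[1+k+1+k]≡Q₄ = cong (λ e → 2 ^ suc e) (+-suc k k)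

  P²≡Q₄ : P * P ≡ Q₄
  P²≡Q₄ = trans (sym (^-distribˡ-+-* 2 (suc k) (suc k))) 2^[1+k+1+k]≡Q₄

  2P≤Q : 2 * P ≤ Q
  2P≤Q = ^-monoʳ-≤ 2 (+-monoˡ-≤ k 2≤k)

  P≤Q : P ≤ Q
  P≤Q = ≤-trans (m≤m+n P (P + 0)) 2P≤Q

  Q≤Q₄ : Q ≤ Q₄
  Q≤Q₄ = ^-monoʳ-≤ 2 {k + k} (m≤n+m (k + k) 2)

  8≤P : 8 ≤ P
  8≤P = ^-monoʳ-≤ 2 {3} {suc k} (s≤s 2≤k)

  1<P : 1 < P
  1<P = ≤-trans (m≤m+n 2 6) 8≤P

  2<P : 2 < P
  2<P = ≤-trans (m≤m+n 3 5) 8≤P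

  P+r<2P : ∀ {r} → r < P → P + r < 2 * P
  P+r<2P = 2^p+r<2^[1+p] (suc k)

  P<2P : P < 2 * P
  P<2P = subst (_< 2 * P) (+-identityʳ P) (P+r<2P (m^n>0 2 (suc k)))

  2P+1<Q₄ : 2 * P + 1 < Q₄
  2P+1<Q₄ = <-≤-trans (2^p+r<2^[1+p] (2 + k) (<-≤-trans 1<P (m≤m+n P (P + 0))))
                      (^-monoʳ-≤ 2 {3 + k} {2 + (k + k)} (s≤s (s≤s (+-monoˡ-≤ k 1≤k))))
    where
    1≤k : 1 ≤ k
    1≤k = ≤-trans (s≤s z≤n) 2≤k

  P+r<Q : ∀ {r} → r < P → P + r < Q
  P+r<Q r<P = <-≤-trans (P+r<2P r<P) 2P≤Q

  s₁[P+r] : ∀ {r} → r < P → s₁ (P + r) ≡ suc (s₁ r)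
  s₁[P+r] = s₁-2^p+ (suc k)

  s₁[2P+1] : s₁ (2 * P + 1) ≡ 2
  s₁[2P+1] = s₁-2^p+ (2 + k) (^-monoʳ-≤ 2 {1} {2 + k} (s≤s z≤n))

  i²<Q₄ : ∀ {i} → i < P → i * i < Q₄
  i²<Q₄ {i} i<P = subst (i * i <_) P²≡Q₄ (*-mono-< i<P i<P)

  i²<Q₁₆ : ∀ {i} → i < 2 * P → i * i < Q₁₆
  i²<Q₁₆ {i} i<2P =
    subst (i * i <_) (trans (double² P) (cong (λ x → 2 * (2 * x)) P²≡Q₄)) (*-mono-< i<2P i<2P)
    where
    double² : ∀ x → 2 * x * (2 * x) ≡ 2 * (2 * (x * x))
    double² = solve-∀

  s₁-square-near-2Q : ∀ {i} → i < P →
                      s₁ ((2 * Q + i) * (2 * Q + i)) ≡ suc (s₁ i) + s₁ (i * i)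
  s₁-square-near-2Q i<P = s₁-square-2^[1+p]+ (k + k) (<-≤-trans i<P P≤Q) (i²<Q₄ i<P)

  s₁-square-near-8Q : ∀ {i} → i < 2 * P →
                      s₁ ((2 * Q₄ + i) * (2 * Q₄ + i)) ≡ suc (s₁ i) + s₁ (i * i)
  s₁-square-near-8Q i<2P =
    s₁-square-2^[1+p]+ (2 + (k + k)) (<-≤-trans i<2P (≤-trans 2P≤Q Q≤Q₄)) (i²<Q₁₆ i<2P)

  agree-right : ∀ {i} → i < P → S (2 * Q + i) ≡ S (2 * Q₄ + i)
  agree-right {i} i<P = thueMorse-cong {(2 * Q + i) * (2 * Q + i)} {(2 * Q₄ + i) * (2 * Q₄ + i)}
    (trans (s₁-square-near-2Q i<P) (sym (s₁-square-near-8Q (<-trans i<P P<2P))))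

  -- From i = P on, the low part i² of (2Q + i)² = (Q + i)·Q₄ + i² reaches Q₄ and carries.
  carry : ∀ q p b r → (q + p) * b + (b + r) ≡ (q + (p + 1)) * b + r
  carry = solve-∀

  s₁-square-2Q+P : s₁ ((2 * Q + P) * (2 * Q + P)) ≡ 3
  s₁-square-2Q+P = begin
    s₁ ((2 * Q + P) * (2 * Q + P))
      ≡⟨ cong s₁ (square-expand Q P) ⟩
    s₁ ((Q + P) * Q₄ + P * P)
      ≡⟨ cong (λ x → s₁ ((Q + P) * Q₄ + x)) (trans P²≡Q₄ (sym (+-identityʳ Q₄))) ⟩
    s₁ ((Q + P) * Q₄ + (Q₄ + 0))
      ≡⟨ cong s₁ (carry Q P Q₄ 0) ⟩
    s₁ ((Q + (P + 1)) * Q₄ + 0)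
      ≡⟨ s₁-split (2 + (k + k)) (Q + (P + 1)) (m^n>0 2 (2 + (k + k))) ⟩
    s₁ (Q + (P + 1)) + 0
      ≡⟨ cong (_+ 0) (s₁-2^p+ (k + k) (P+r<Q 1<P)) ⟩
    suc (s₁ (P + 1)) + 0
      ≡⟨ cong (λ x → suc x + 0) (s₁[P+r] 1<P) ⟩
    3 ∎
    where open ≡-Reasoning

  s₁-square-8Q+P : s₁ ((2 * Q₄ + P) * (2 * Q₄ + P)) ≡ 3
  s₁-square-8Q+P = begin
    s₁ ((2 * Q₄ + P) * (2 * Q₄ + P))
      ≡⟨ s₁-square-near-8Q P<2P ⟩
    suc (s₁ P) + s₁ (P * P)
      ≡⟨ cong₂ (λ x y → suc x + s₁ y) (s₁-2^p (suc k)) P²≡Q₄ ⟩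
    2 + s₁ Q₄
      ≡⟨ cong (2 +_) (s₁-2^p (2 + (k + k))) ⟩
    3 ∎
    where open ≡-Reasoning

  [P+1]²≡Q₄+[2P+1] : (P + 1) * (P + 1) ≡ Q₄ + (2 * P + 1)
  [P+1]²≡Q₄+[2P+1] = trans (square-succ P) (cong (_+ (2 * P + 1)) P²≡Q₄)
    where
    square-succ : ∀ x → (x + 1) * (x + 1) ≡ x * x + (2 * x + 1)
    square-succ = solve-∀

  s₁-square-2Q+P+1 : s₁ ((2 * Q + (P + 1)) * (2 * Q + (P + 1))) ≡ 5
  s₁-square-2Q+P+1 = begin
    s₁ ((2 * Q + (P + 1)) * (2 * Q + (P + 1)))
      ≡⟨ cong s₁ (square-expand Q (P + 1)) ⟩
    s₁ ((Q + (P + 1)) * Q₄ + (P + 1) * (P + 1))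
      ≡⟨ cong (λ x → s₁ ((Q + (P + 1)) * Q₄ + x)) [P+1]²≡Q₄+[2P+1] ⟩
    s₁ ((Q + (P + 1)) * Q₄ + (Q₄ + (2 * P + 1)))
      ≡⟨ cong s₁ (carry Q (P + 1) Q₄ (2 * P + 1)) ⟩
    s₁ ((Q + (P + 1 + 1)) * Q₄ + (2 * P + 1))
      ≡⟨ s₁-split (2 + (k + k)) (Q + (P + 1 + 1)) 2P+1<Q₄ ⟩
    s₁ (Q + (P + 1 + 1)) + s₁ (2 * P + 1)
      ≡⟨ cong₂ _+_ (cong (λ x → s₁ (Q + x)) (+-assoc P 1 1)) s₁[2P+1] ⟩
    s₁ (Q + (P + 2)) + 2
      ≡⟨ cong (_+ 2) (s₁-2^p+ (k + k) (P+r<Q 2<P)) ⟩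
    suc (s₁ (P + 2)) + 2
      ≡⟨ cong (λ x → suc x + 2) (s₁[P+r] 2<P) ⟩
    5 ∎
    where open ≡-Reasoning

  s₁-square-8Q+P+1 : s₁ ((2 * Q₄ + (P + 1)) * (2 * Q₄ + (P + 1))) ≡ 6
  s₁-square-8Q+P+1 = begin
    s₁ ((2 * Q₄ + (P + 1)) * (2 * Q₄ + (P + 1)))
      ≡⟨ s₁-square-near-8Q (P+r<2P 1<P) ⟩
    suc (s₁ (P + 1)) + s₁ ((P + 1) * (P + 1))
      ≡⟨ cong₂ (λ x y → suc x + s₁ y) (s₁[P+r] 1<P) [P+1]²≡Q₄+[2P+1] ⟩
    3 + s₁ (Q₄ + (2 * P + 1))
      ≡⟨ cong (3 +_) (s₁-2^p+ (2 + (k + k)) 2P+1<Q₄) ⟩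
    3 + suc (s₁ (2 * P + 1))
      ≡⟨ cong (λ x → 3 + suc x) s₁[2P+1] ⟩
    6 ∎
    where open ≡-Reasoning

  agree-centre : S (2 * Q + P) ≡ S (2 * Q₄ + P)
  agree-centre = thueMorse-cong {(2 * Q + P) * (2 * Q + P)} {(2 * Q₄ + P) * (2 * Q₄ + P)}
                   (trans s₁-square-2Q+P (sym s₁-square-8Q+P))

  differ-after-centre : S (2 * Q + (P + 1)) ≢ S (2 * Q₄ + (P + 1))
  differ-after-centre eq = true≢false (trans (sym x-odd) (trans eq y-even))
    where
    x-odd : S (2 * Q + (P + 1)) ≡ true
    x-odd = thueMorse-value {(2 * Q + (P + 1)) * (2 * Q + (P + 1))} s₁-square-2Q+P+1
    y-even : S (2 * Q₄ + (P + 1)) ≡ false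
    y-even = thueMorse-value {(2 * Q₄ + (P + 1)) * (2 * Q₄ + (P + 1))} s₁-square-8Q+P+1
    true≢false : true ≢ false
    true≢false ()

  agree-right≤ : ∀ {i} → i ≤ P → S (2 * Q + i) ≡ S (2 * Q₄ + i)
  agree-right≤ i≤P with m≤n⇒m<n∨m≡n i≤P
  ... | inj₁ i<P  = agree-right i<P
  ... | inj₂ refl = agree-centre

  s₁-square-2v+j : ∀ {v j} → v + j ≡ Q → j < P →
                   s₁ ((2 * v + j) * (2 * v + j)) ≡ s₁ v + s₁ (j * j)
  s₁-square-2v+j {v} {j} v+j≡Q j<P = begin
    s₁ ((2 * v + j) * (2 * v + j))          ≡⟨ cong s₁ (expand v j) ⟩
    s₁ (v * (2 * (2 * (v + j))) + j * j)    ≡⟨ cong (λ x → s₁ (v * (2 * (2 * x)) + j * j)) v+j≡Q ⟩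
    s₁ (v * Q₄ + j * j)                     ≡⟨ s₁-split (2 + (k + k)) v (i²<Q₄ j<P) ⟩
    s₁ v + s₁ (j * j)                       ∎
    where
    open ≡-Reasoning
    expand : ∀ v j → (2 * v + j) * (2 * v + j) ≡ v * (2 * (2 * (v + j))) + j * j
    expand = solve-∀

  s₁-square-8v+7j : ∀ {v j} → v + j ≡ Q → 0 < j → j < P →
                    s₁ ((8 * v + 7 * j) * (8 * v + 7 * j)) ≡ 2 + (s₁ v + s₁ (j * j))
  s₁-square-8v+7j {v} {j} v+j≡Q 0<j j<P = begin
    s₁ ((8 * v + 7 * j) * (8 * v + 7 * j))
      ≡⟨ cong s₁ (expand v j) ⟩
    s₁ ((3 * (v + j) + v) * (2 * (2 * (2 * (2 * (v + j))))) + j * j)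
      ≡⟨ cong (λ x → s₁ ((3 * x + v) * (2 * (2 * (2 * (2 * x)))) + j * j)) v+j≡Q ⟩
    s₁ ((3 * Q + v) * Q₁₆ + j * j)
      ≡⟨ s₁-split (4 + (k + k)) (3 * Q + v) (i²<Q₁₆ (<-trans j<P P<2P)) ⟩
    s₁ (3 * Q + v) + s₁ (j * j)
      ≡⟨ cong (_+ s₁ (j * j)) (s₁-split (k + k) 3 v<Q) ⟩
    2 + s₁ v + s₁ (j * j)
      ≡⟨ +-assoc 2 (s₁ v) (s₁ (j * j)) ⟩
    2 + (s₁ v + s₁ (j * j)) ∎
    where
    open ≡-Reasoning
    expand : ∀ v j → (8 * v + 7 * j) * (8 * v + 7 * j)
                   ≡ (3 * (v + j) + v) * (2 * (2 * (2 * (2 * (v + j))))) + j * j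
    expand = solve-∀
    v<Q : v < Q
    v<Q = subst (v <_) v+j≡Q (m<m+n v 0<j)

  agree-left : ∀ {v j} → v + j ≡ Q → 0 < j → j < P → S (2 * v + j) ≡ S (8 * v + 7 * j)
  agree-left {v} {j} v+j≡Q 0<j j<P =
    thueMorse-+2 {(2 * v + j) * (2 * v + j)} {(8 * v + 7 * j) * (8 * v + 7 * j)}
      (trans (s₁-square-8v+7j v+j≡Q 0<j j<P) (cong (2 +_) (sym (s₁-square-2v+j v+j≡Q j<P))))

  start : ℕ
  start = 2 * Q + 1 ∸ P

  start+P : start + P ≡ 2 * Q + 1
  start+P = m∸n+n≡m (≤-trans P≤Q (≤-trans (m≤m+n Q (Q + 0)) (m≤m+n (2 * Q) 1)))

  position-left : ∀ {u v j} → suc u + j ≡ P → v + j ≡ Q → start + u ≡ 2 * v + j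
  position-left {u} {v} {j} 1+u+j≡P v+j≡Q = +-cancelʳ-≡ (suc j) (start + u) (2 * v + j) (begin
    start + u + suc j      ≡⟨ regroup start u j ⟩
    start + (suc u + j)    ≡⟨ cong (start +_) 1+u+j≡P ⟩
    start + P              ≡⟨ start+P ⟩
    2 * Q + 1              ≡⟨ cong (λ x → 2 * x + 1) v+j≡Q ⟨
    2 * (v + j) + 1        ≡⟨ split v j ⟩
    2 * v + j + suc j      ∎)
    where
    open ≡-Reasoning
    regroup : ∀ s u j → s + u + suc j ≡ s + (suc u + j)
    regroup = solve-∀
    split : ∀ v j → 2 * (v + j) + 1 ≡ 2 * v + j + suc j
    split = solve-∀

  position-right : ∀ {u i} → P + i ≡ suc u → start + u ≡ 2 * Q + i
  position-right {u} {i} P+i≡1+u = +-cancelʳ-≡ P (start + u) (2 * Q + i) (begin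
    start + u + P      ≡⟨ swap start u P ⟩
    start + P + u      ≡⟨ cong (_+ u) start+P ⟩
    2 * Q + 1 + u      ≡⟨ +-assoc (2 * Q) 1 u ⟩
    2 * Q + suc u      ≡⟨ cong (2 * Q +_) P+i≡1+u ⟨
    2 * Q + (P + i)    ≡⟨ swap′ (2 * Q) P i ⟩
    2 * Q + i + P      ∎)
    where
    open ≡-Reasoning
    swap : ∀ x y z → x + y + z ≡ x + z + y
    swap = solve-∀
    swap′ : ∀ x y z → x + (y + z) ≡ x + z + y
    swap′ = solve-∀

  gap : ℕ
  gap = 6 * Q

  position-second : ∀ {u x} → start + u ≡ x → start + gap + u ≡ x + gap
  position-second {u} eq = trans (+-assoc start gap u) (trans (cong (start +_) (+-comm gap u))
                                 (trans (sym (+-assoc start u gap)) (cong (_+ gap) eq)))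

  right-shifted : ∀ i → 2 * Q + i + gap ≡ 2 * Q₄ + i
  right-shifted = shift Q
    where
    shift : ∀ q i → 2 * q + i + 6 * q ≡ 2 * (2 * (2 * q)) + i
    shift = solve-∀

  agree-before-centre : ∀ {u} → suc u < P → S (start + u) ≡ S (start + gap + u)
  agree-before-centre {u} 1+u<P =
    subst₂ (λ x y → S x ≡ S y) (sym first) (sym (trans (position-second first) second))
           (agree-left v+j≡Q (m<n⇒0<n∸m 1+u<P) j<P)
    where
    j v : ℕ
    j = P ∸ suc u
    v = Q ∸ j
    1+u+j≡P : suc u + j ≡ P
    1+u+j≡P = m+[n∸m]≡n (<⇒≤ 1+u<P)
    j<P : j < P
    j<P = subst (j <_) 1+u+j≡P (m<n+m j (s≤s z≤n))
    v+j≡Q : v + j ≡ Q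
    v+j≡Q = m∸n+n≡m (≤-trans (<⇒≤ j<P) P≤Q)
    first : start + u ≡ 2 * v + j
    first = position-left 1+u+j≡P v+j≡Q
    second : 2 * v + j + gap ≡ 8 * v + 7 * j
    second = trans (cong (λ x → 2 * v + j + 6 * x) (sym v+j≡Q)) (spread v j)
      where
      spread : ∀ v j → 2 * v + j + 6 * (v + j) ≡ 8 * v + 7 * j
      spread = solve-∀

  agree-from-centre : ∀ {u} → P ≤ suc u → u < 2 * P → S (start + u) ≡ S (start + gap + u)
  agree-from-centre {u} P≤1+u u<2P =
    subst₂ (λ x y → S x ≡ S y) (sym first) (sym (trans (position-second first) (right-shifted i)))
           (agree-right≤ i≤P)
    where
    i : ℕ
    i = suc u ∸ P
    P+i≡1+u : P + i ≡ suc u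
    P+i≡1+u = m+[n∸m]≡n P≤1+u
    i≤P : i ≤ P
    i≤P = +-cancelˡ-≤ P i P (subst₂ _≤_ (sym P+i≡1+u) (cong (P +_) (+-identityʳ P)) u<2P)
    first : start + u ≡ 2 * Q + i
    first = position-right P+i≡1+u

  agree : ∀ {u} → u < 2 * P → S (start + u) ≡ S (start + gap + u)
  agree {u} u<2P with suc u <? P
  ... | yes 1+u<P = agree-before-centre 1+u<P
  ... | no 1+u≮P  = agree-from-centre (≮⇒≥ 1+u≮P) u<2P

  end-first : start + 2 * P ≡ 2 * Q + (P + 1)
  end-first = position-right (twice+1 P)
    where
    twice+1 : ∀ p → p + (p + 1) ≡ suc (2 * p)
    twice+1 = solve-∀

  end-second : start + gap + 2 * P ≡ 2 * Q₄ + (P + 1)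
  end-second = trans (position-second end-first) (right-shifted (P + 1))

  collision : ∀ {N} → threshold k ≤ N → Collision S N (2 * P)
  collision {N} threshold≤N = record
    { i      = start
    ; j      = start + gap
    ; i-fits = ≤-trans (+-monoˡ-≤ 1 (+-monoˡ-≤ (2 * P) (m≤m+n start gap))) j-fits
    ; j-fits = j-fits
    ; agree  = agree
    ; differ = subst₂ (λ x y → S x ≢ S y) (sym end-first) (sym end-second)
                      differ-after-centre
    }
    where
    j-fits : start + gap + 2 * P + 1 ≤ N
    j-fits = subst (_≤ N) (sym (trans (cong (_+ 1) end-second) (total Q P))) threshold≤N
      where
      total : ∀ q p → 2 * (2 * (2 * q)) + (p + 1) + 1 ≡ 8 * q + p + 2
      total = solve-∀

  bound : ∀ {N} → N < threshold (suc k) → 2 * N ≤ 5 * (suc (2 * P) * suc (2 * P))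
  bound {N} N<threshold = begin
    2 * N
      ≤⟨ *-monoʳ-≤ 2 N≤ ⟩
    2 * (8 * Q₄ + 2 * P + 1)
      ≤⟨ m≤m+n _ (4 * Q₄ + 16 * P + 3) ⟩
    2 * (8 * Q₄ + 2 * P + 1) + (4 * Q₄ + 16 * P + 3)
      ≡⟨ cong (λ x → 2 * (8 * x + 2 * P + 1) + (4 * x + 16 * P + 3)) P²≡Q₄ ⟨
    2 * (8 * (P * P) + 2 * P + 1) + (4 * (P * P) + 16 * P + 3)
      ≡⟨ expand P ⟨
    5 * (suc (2 * P) * suc (2 * P)) ∎
    where
    open ≤-Reasoning
    expand : ∀ p → 5 * (suc (2 * p) * suc (2 * p))
                 ≡ 2 * (8 * (p * p) + 2 * p + 1) + (4 * (p * p) + 16 * p + 3)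
    expand = solve-∀
    N≤ : N ≤ 8 * Q₄ + 2 * P + 1
    N≤ = s≤s⁻¹ (subst (N <_) (trans (cong (λ x → 8 * x + 2 * P + 2) 2^[1+k+1+k]≡Q₄) (+-suc _ 1))
                       N<threshold)

bracket : ∀ (g : ℕ → ℕ) {m N} → g m ≤ N → ∀ d → N < g (d + m) →
          ∃[ k ] m ≤ k × g k ≤ N × N < g (suc k)
bracket g lo zero hi = ⊥-elim (<⇒≱ hi lo)
bracket g {m} {N} lo (suc d) hi with g (d + m) ≤? N
... | yes le = d + m , m≤n+m m d , le , hi
... | no nle = bracket g lo d (≰⇒> nle)

n<threshold : ∀ n → n < threshold n
n<threshold n = begin-strict
  n                                  <⟨ n<2^n n ⟩
  2 ^ n                              ≤⟨ ^-monoʳ-≤ 2 {n} {n + n} (m≤m+n n n) ⟩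
  2 ^ (n + n)                        ≤⟨ m≤n*m (2 ^ (n + n)) 8 ⟩
  8 * 2 ^ (n + n)                    ≤⟨ m≤m+n (8 * 2 ^ (n + n)) (2 ^ suc n) ⟩
  8 * 2 ^ (n + n) + 2 ^ suc n        ≤⟨ m≤m+n (8 * 2 ^ (n + n) + 2 ^ suc n) 2 ⟩
  threshold n                        ∎
  where open ≤-Reasoning

squares-nonconstant : ∀ {N} → 3 ≤ N → ¬ Σ Bool (ConstPrefix thueMorseSquares N)
squares-nonconstant 3≤N (a , constant)
  with trans (constant 0 (≤-trans (m≤m+n 2 1) 3≤N)) (sym (constant 1 3≤N))
... | ()

collision-short : ∀ {N} → 10 ≤ N → Collision thueMorseSquares N 6
collision-short 10≤N = record
  { i = 0 ; j = 3 ; i-fits = ≤-trans (m≤m+n 7 3) 10≤N ; j-fits = 10≤N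
  ; agree  = toWitness {a? = allUpTo? (λ u → thueMorseSquares u Bool.≟ thueMorseSquares (3 + u)) 6} tt
  ; differ = λ ()
  }

collision-medium : ∀ {N} → 23 ≤ N → Collision thueMorseSquares N 7
collision-medium 23≤N = record
  { i = 6 ; j = 15 ; i-fits = ≤-trans (m≤m+n 14 9) 23≤N ; j-fits = 23≤N
  ; agree  = toWitness {a? = allUpTo? (λ u → thueMorseSquares (6 + u) Bool.≟ thueMorseSquares (15 + u)) 7} tt
  ; differ = λ ()
  }

squares-collision : ∀ N → 21 ≤ N → ∃[ L ] Collision thueMorseSquares N L × 2 * N ≤ 5 * (suc L * suc L)
squares-collision N 21≤N with N <? 23 | N <? threshold 2
... | yes N<23 | _ =
  6 , collision-short (≤-trans (m≤m+n 10 11) 21≤N) , ≤-trans (*-monoʳ-≤ 2 (s≤s⁻¹ N<23)) (m≤m+n 44 201)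
... | no N≮23 | yes N<138 =
  7 , collision-medium (≮⇒≥ N≮23) , ≤-trans (*-monoʳ-≤ 2 (s≤s⁻¹ N<138)) (m≤m+n 274 46)
... | no _ | no N≮138
  with bracket threshold (≮⇒≥ N≮138) N (<-trans (m<m+n N (s≤s z≤n)) (n<threshold (N + 2)))
... | k , 2≤k , lo , hi = 2 * P , collision lo , bound hi
  where open SquaresCollision k 2≤k

theorem1 : ∀ (N : ℕ) → 21 ≤ N →
    ∃[ M ] (IsMOC thueMorseSquares N M × 2 * N ≤ 5 * (M * M))
theorem1 N 21≤N with squares-collision N 21≤N
... | L , c , 2N≤5[L+1]²
  with complexity-above-collision (squares-nonconstant (≤-trans (m≤m+n 3 18) 21≤N)) c
... | M , moc , L<M = M , moc , ≤-trans 2N≤5[L+1]² (*-monoʳ-≤ 5 (*-mono-≤ L<M L<M))
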